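{- Let $Q=(q_k)_{k\ge1}$ be a sequence of integers with $q_k>1$ for all $k$, and let $p,r$ be positive integers with $\gcd(p,r)=1$ and $p<r$. Let $x=\Delta^Q_{\delta_1\delta_2\ldots\delta_n\ldots}=\sum_{n=1}^{\infty}\frac{\delta_n}{q_1q_2\cdots q_n}\in(0,1)$, where $\delta_n\in\{0,1,\dots,q_n-1\}$ and the digit sequence follows the representation convention stated in the context. Define $\Delta_1=pq_1$ and, for $n\ge2$, $\Delta_n=q_n(\Delta_{n-1}-r\delta_{n-1})$. Then $x=\frac{p}{r}$ if and only if $\delta_1=\left[\frac{\Delta_1}{r}\right]$ and $$\delta_n=\left[\frac{q_n(\Delta_{n-1}-r\delta_{n-1})}{r}\right]\quad\text{for all integers } n>1.$$
   Context: For a sequence $Q=(q_k)$ of integers $q_k>1$ and digits $\varepsilon_k\in\{0,1,\dots,q_k-1\}$, the notation $\Delta^Q_{\varepsilon_1\varepsilon_2\ldots\varepsilon_k\ldots}$ denotes the number $\sum_{k=1}^\infty\frac{\varepsilon_k}{q_1q_2\cdots q_k}\in[0,1]$. Some numbers (called $Q$-rational) have two representations, $\Delta^Q_{\varepsilon_1\ldots\varepsilon_{m-1}\varepsilon_m000\ldots}=\Delta^Q_{\varepsilon_1\ldots\varepsilon_{m-1}[\varepsilon_m-1][q_{m+1}-1][q_{m+2}-1]\ldots}$; the convention is that the representation ending in zeros is used, i.e. the digit sequence is never eventually equal to $q_k-1$. $[a]$ denotes the integer part of $a$. -}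

module Defs where

open import Data.Nat as ℕ using (ℕ; zero; suc; _<_; _≤_; NonZero)
open import Data.Nat.Properties as ℕP using ()
open import Data.Integer as ℤ using (ℤ; +_)
open import Data.Rational as ℚ using (ℚ; 0ℚ)
open import Data.Product using (Σ; ∃; _×_; _,_)

-- Indexing convention: everything is 0-indexed, i.e. q k stands for the
-- paper's q_{k+1} and δ k for the paper's δ_{k+1}.

qprod : (ℕ → ℕ) → ℕ → ℕ
qprod q zero    = q zero
qprod q (suc k) = qprod q k ℕ.* q (suc k)

qprod-nonZero : (q : ℕ → ℕ) → (∀ k → 1 < q k) → ∀ k → NonZero (qprod q k)
qprod-nonZero q hq zero    = ℕ.>-nonZero (ℕP.<-trans (ℕ.s≤s ℕ.z≤n) (hq zero))
qprod-nonZero q hq (suc k) =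
  ℕP.m*n≢0 (qprod q k) (q (suc k)) {{qprod-nonZero q hq k}}
    {{ℕ.>-nonZero (ℕP.<-trans (ℕ.s≤s ℕ.z≤n) (hq (suc k)))}}

term : (q : ℕ → ℕ) → (∀ k → 1 < q k) → (δ : ℕ → ℕ) → ℕ → ℚ
term q hq δ k = ℚ._/_ (+ δ k) (qprod q k) {{qprod-nonZero q hq k}}

partialSum : (q : ℕ → ℕ) → (∀ k → 1 < q k) → (δ : ℕ → ℕ) → ℕ → ℚ
partialSum q hq δ zero    = 0ℚ
partialSum q hq δ (suc N) = partialSum q hq δ N ℚ.+ term q hq δ N

ConvergesTo : (ℕ → ℚ) → ℚ → Set
ConvergesTo s L = ∀ (ε : ℚ) → 0ℚ ℚ.< ε → ∃ λ N → ∀ n → N ≤ n → ℚ.∣ s n ℚ.- L ∣ ℚ.< ε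

Delta : (q δ : ℕ → ℕ) (p r : ℕ) → ℕ → ℤ
Delta q δ p r zero    = + p ℤ.* + q zero
Delta q δ p r (suc n) = + q (suc n) ℤ.* (Delta q δ p r n ℤ.- + r ℤ.* + δ n)

-- Let D n = q₀⋯qₙ and let N n / D n be the partial sum S_{n+1} of the first
-- n+1 terms δ_k / (q₀⋯q_k).  By induction, Δ_n = r·δ_n + (p·D n − r·N n), so
-- the digit rule δ_n = ⌊Δ_n / r⌋ says exactly that 0 ≤ p·D n − r·N n < r,
-- i.e. that p/r is bracketed as S_{n+1} ≤ p/r < U n := (N n + 1) / D n.
-- The theorem therefore reduces to:  S → p/r  iff  p/r is bracketed at every
-- level.  If every level is bracketed, |S_{n+1} − p/r| < 1/D n ≤ 1/(n+1), so
-- S converges.  Conversely the limit of the nondecreasing S lies above every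
-- S_{n+1}, and below every U k; since U never increases and strictly drops at
-- every non-maximal digit, a limit reaching U n would force all later digits
-- to be maximal, which the representation convention excludes.

module Submission where

open import Defs
open import Data.Nat as ℕ using (ℕ; suc; _<_; _≤_; NonZero)
open import Data.Nat.GCD using (gcd)
open import Data.Integer as ℤ using (ℤ; +_)
open import Data.Rational as ℚ using (ℚ; 0ℚ; 1ℚ)
open import Data.Product using (∃; _×_; _,_)
open import Relation.Binary.PropositionalEquality using (_≡_)
open import Relation.Nullary using (¬_)
open import Function.Bundles using (_⇔_)

open import Data.Nat using (zero; s≤s)
import Data.Nat.Properties as ℕP
import Data.Nat.Tactic.RingSolver as ℕSolver
open import Data.Integer using (+[1+_]; +0; -[1+_])
import Data.Integer.Properties as ℤP
open import Data.Integer.DivMod using (div-pos-is-/ℕ; [n/ℕd]*d≤n; n<s[n/ℕd]*d)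
open import Data.Integer.Tactic.RingSolver using (solve-∀)
open import Data.Rational using (mkℚ)
import Data.Rational.Properties as ℚP
open import Data.Rational.Unnormalised as ℚᵘ using (mkℚᵘ; *≤*; *<*; *≡*)
import Data.Rational.Unnormalised.Properties as ℚᵘP
open import Data.Product using (proj₁; proj₂)
open import Data.Empty using (⊥-elim)
open import Relation.Nullary using (yes; no)
open import Relation.Binary.PropositionalEquality
  using (_≢_; refl; sym; trans; cong; cong₂; subst; subst₂; module ≡-Reasoning)
open import Function.Bundles using (mk⇔; Equivalence)
open import Function.Construct.Composition using (_⇔-∘_)
open import Function.Construct.Symmetry using (⇔-sym)
open import Data.Product.Function.NonDependent.Propositional using (_×-⇔_)
open import Function.Properties.Equivalence using (⇔-setoid)
open import Level using (0ℓ)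
import Relation.Binary.Reasoning.Setoid as SetoidReasoning
open import Data.Rational.Solver using (module +-*-Solver)
open Equivalence

module ⇔-Reasoning = SetoidReasoning (⇔-setoid 0ℓ)

toℚᵘ-/ : ∀ (i : ℤ) n .{{_ : NonZero n}} → ℚ.toℚᵘ (i ℚ./ n) ℚᵘ.≃ (i ℚᵘ./ n)
toℚᵘ-/ i (suc n) = ℚP.toℚᵘ-fromℚᵘ (mkℚᵘ i n)

/-≤⇔ : ∀ (i j : ℤ) n m .{{_ : NonZero n}} .{{_ : NonZero m}} →
  (i ℚ./ n ℚ.≤ j ℚ./ m) ⇔ (i ℤ.* + m ℤ.≤ j ℤ.* + n)
/-≤⇔ i j n@(suc _) m@(suc _) = mk⇔
  (λ h → ℚᵘP.drop-*≤* (resp (toℚᵘ-/ i n) (toℚᵘ-/ j m) (ℚP.toℚᵘ-mono-≤ h)))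
  (λ h → ℚP.toℚᵘ-cancel-≤ (resp (ℚᵘP.≃-sym (toℚᵘ-/ i n)) (ℚᵘP.≃-sym (toℚᵘ-/ j m)) (*≤* h)))
  where
  resp : ∀ {a b c d} → a ℚᵘ.≃ b → c ℚᵘ.≃ d → a ℚᵘ.≤ c → b ℚᵘ.≤ d
  resp a≃b c≃d a≤c = ℚᵘP.≤-respʳ-≃ c≃d (ℚᵘP.≤-respˡ-≃ a≃b a≤c)

/-<⇔ : ∀ (i j : ℤ) n m .{{_ : NonZero n}} .{{_ : NonZero m}} →
  (i ℚ./ n ℚ.< j ℚ./ m) ⇔ (i ℤ.* + m ℤ.< j ℤ.* + n)
/-<⇔ i j n@(suc _) m@(suc _) = mk⇔
  (λ h → ℚᵘP.drop-*<* (resp (toℚᵘ-/ i n) (toℚᵘ-/ j m) (ℚP.toℚᵘ-mono-< h)))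
  (λ h → ℚP.toℚᵘ-cancel-< (resp (ℚᵘP.≃-sym (toℚᵘ-/ i n)) (ℚᵘP.≃-sym (toℚᵘ-/ j m)) (*<* h)))
  where
  resp : ∀ {a b c d} → a ℚᵘ.≃ b → c ℚᵘ.≃ d → a ℚᵘ.< c → b ℚᵘ.< d
  resp a≃b c≃d a<c = ℚᵘP.<-respʳ-≃ c≃d (ℚᵘP.<-respˡ-≃ a≃b a<c)

/-cross : ∀ (i j : ℤ) n m .{{_ : NonZero n}} .{{_ : NonZero m}} →
  i ℤ.* + m ≡ j ℤ.* + n → i ℚ./ n ≡ j ℚ./ m
/-cross i j n@(suc _) m@(suc _) h = ℚP.toℚᵘ-injective
  (ℚᵘP.≃-trans (toℚᵘ-/ i n) (ℚᵘP.≃-trans (*≡* h) (ℚᵘP.≃-sym (toℚᵘ-/ j m))))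

/-+ : ∀ (i j : ℤ) n m .{{_ : NonZero n}} .{{_ : NonZero m}} →
  i ℚ./ n ℚ.+ j ℚ./ m ≡ ((i ℤ.* + m ℤ.+ j ℤ.* + n) ℚ./ (n ℕ.* m)) {{ℕP.m*n≢0 n m}}
/-+ i j n@(suc _) m@(suc _) = ℚP.toℚᵘ-injective
  (ℚᵘP.≃-trans (ℚP.toℚᵘ-homo-+ (i ℚ./ n) (j ℚ./ m))
  (ℚᵘP.≃-trans (ℚᵘP.+-cong (toℚᵘ-/ i n) (toℚᵘ-/ j m))
     (ℚᵘP.≃-sym (toℚᵘ-/ (i ℤ.* + m ℤ.+ j ℤ.* + n) (n ℕ.* m) {{ℕP.m*n≢0 n m}}))))

/-+-refine : ∀ (i j : ℤ) n c .{{_ : NonZero n}} .{{_ : NonZero (n ℕ.* c)}} →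
  i ℚ./ n ℚ.+ j ℚ./ (n ℕ.* c) ≡ (i ℤ.* + c ℤ.+ j) ℚ./ (n ℕ.* c)
/-+-refine i j n c = trans (/-+ i j n (n ℕ.* c))
  (/-cross (i ℤ.* + (n ℕ.* c) ℤ.+ j ℤ.* + n) (i ℤ.* + c ℤ.+ j) (n ℕ.* (n ℕ.* c)) (n ℕ.* c)
    {{ℕP.m*n≢0 n (n ℕ.* c)}} cross)
  where
  identity : ∀ i j n c →
    (i ℤ.* (n ℤ.* c) ℤ.+ j ℤ.* n) ℤ.* (n ℤ.* c) ≡ (i ℤ.* c ℤ.+ j) ℤ.* (n ℤ.* (n ℤ.* c))
  identity = solve-∀
  cross : (i ℤ.* + (n ℕ.* c) ℤ.+ j ℤ.* + n) ℤ.* + (n ℕ.* c)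
            ≡ (i ℤ.* + c ℤ.+ j) ℤ.* + (n ℕ.* (n ℕ.* c))
  cross = subst₂ (λ x y → (i ℤ.* x ℤ.+ j ℤ.* + n) ℤ.* x ≡ (i ℤ.* + c ℤ.+ j) ℤ.* y)
    (sym (ℤP.pos-* n c)) (sym (trans (ℤP.pos-* n (n ℕ.* c)) (cong (+ n ℤ.*_) (ℤP.pos-* n c))))
    (identity i j (+ n) (+ c))

/-+-same : ∀ (i j : ℤ) n .{{_ : NonZero n}} → i ℚ./ n ℚ.+ j ℚ./ n ≡ (i ℤ.+ j) ℚ./ n
/-+-same i j n = trans (/-+ i j n n)
  (/-cross (i ℤ.* + n ℤ.+ j ℤ.* + n) (i ℤ.+ j) (n ℕ.* n) n {{ℕP.m*n≢0 n n}} cross)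
  where
  identity : ∀ i j n → (i ℤ.* n ℤ.+ j ℤ.* n) ℤ.* n ≡ (i ℤ.+ j) ℤ.* (n ℤ.* n)
  identity = solve-∀
  cross : (i ℤ.* + n ℤ.+ j ℤ.* + n) ℤ.* + n ≡ (i ℤ.+ j) ℤ.* + (n ℕ.* n)
  cross = trans (identity i j (+ n)) (cong ((i ℤ.+ j) ℤ.*_) (sym (ℤP.pos-* n n)))

ℕ/-≤⇔ : ∀ a b n m .{{_ : NonZero n}} .{{_ : NonZero m}} →
  (+ a ℚ./ n ℚ.≤ + b ℚ./ m) ⇔ (a ℕ.* m ≤ b ℕ.* n)
ℕ/-≤⇔ a b n m = begin
  (+ a ℚ./ n ℚ.≤ + b ℚ./ m)       ≈⟨ /-≤⇔ (+ a) (+ b) n m ⟩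
  (+ a ℤ.* + m ℤ.≤ + b ℤ.* + n)   ≡⟨ cong₂ ℤ._≤_ (sym (ℤP.pos-* a m)) (sym (ℤP.pos-* b n)) ⟩
  (+ (a ℕ.* m) ℤ.≤ + (b ℕ.* n))   ≈⟨ mk⇔ ℤP.drop‿+≤+ ℤ.+≤+ ⟩
  (a ℕ.* m ≤ b ℕ.* n)             ∎
  where open ⇔-Reasoning

ℕ/-<⇔ : ∀ a b n m .{{_ : NonZero n}} .{{_ : NonZero m}} →
  (+ a ℚ./ n ℚ.< + b ℚ./ m) ⇔ (a ℕ.* m < b ℕ.* n)
ℕ/-<⇔ a b n m = begin
  (+ a ℚ./ n ℚ.< + b ℚ./ m)       ≈⟨ /-<⇔ (+ a) (+ b) n m ⟩
  (+ a ℤ.* + m ℤ.< + b ℤ.* + n)   ≡⟨ cong₂ ℤ._<_ (sym (ℤP.pos-* a m)) (sym (ℤP.pos-* b n)) ⟩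
  (+ (a ℕ.* m) ℤ.< + (b ℕ.* n))   ≈⟨ mk⇔ ℤP.drop‿+<+ ℤ.+<+ ⟩
  (a ℕ.* m < b ℕ.* n)             ∎
  where open ⇔-Reasoning

reassoc : ∀ b c n → b ℕ.* c ℕ.* n ≡ b ℕ.* (n ℕ.* c)
reassoc = ℕSolver.solve-∀

refine-≤ : ∀ a b n c .{{_ : NonZero n}} .{{_ : NonZero (n ℕ.* c)}} →
  a ≤ b ℕ.* c → + a ℚ./ (n ℕ.* c) ℚ.≤ + b ℚ./ n
refine-≤ a b n c a≤bc = from (ℕ/-≤⇔ a b (n ℕ.* c) n)
  (subst (a ℕ.* n ℕ.≤_) (reassoc b c n) (ℕP.*-monoˡ-≤ n a≤bc))

refine-< : ∀ a b n c .{{_ : NonZero n}} .{{_ : NonZero (n ℕ.* c)}} →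
  a < b ℕ.* c → + a ℚ./ (n ℕ.* c) ℚ.< + b ℚ./ n
refine-< a b n c a<bc = from (ℕ/-<⇔ a b (n ℕ.* c) n)
  (subst (a ℕ.* n ℕ.<_) (reassoc b c n) (ℕP.*-monoˡ-< n a<bc))

multiples-bracket : ∀ {k l i : ℤ} n .{{_ : NonZero n}} →
  k ℤ.* + n ℤ.≤ i → i ℤ.< ℤ.suc l ℤ.* + n → k ℤ.≤ l
multiples-bracket {k} {l} n lower upper =
  subst (k ℤ.≤_) (ℤP.pred-suc l) (ℤP.i<j⇒i≤pred[j] k<1+l)
  where
  k<1+l : k ℤ.< ℤ.suc l
  k<1+l = ℤP.*-cancelʳ-<-nonNeg (+ n) (ℤP.≤-<-trans lower upper)

floor-char : ∀ (k : ℤ) (x : ℚ) →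
  (k ≡ ℚ.floor x) ⇔ ((k ℤ.* ℚ.↧ x ℤ.≤ ℚ.↥ x) × (ℚ.↥ x ℤ.< ℤ.suc k ℤ.* ℚ.↧ x))
floor-char k x@(mkℚ a d _) = mk⇔ (λ { refl → lower , upper })
  λ (l , u) → ℤP.≤-antisym (multiples-bracket (suc d) l upper) (multiples-bracket (suc d) lower u)
  where
  lower : ℚ.floor x ℤ.* + suc d ℤ.≤ a
  lower = subst (λ f → f ℤ.* + suc d ℤ.≤ a) (sym (div-pos-is-/ℕ a (suc d))) ([n/ℕd]*d≤n a (suc d))
  upper : a ℤ.< ℤ.suc (ℚ.floor x) ℤ.* + suc d
  upper = subst (λ f → a ℤ.< ℤ.suc f ℤ.* + suc d) (sym (div-pos-is-/ℕ a (suc d))) (n<s[n/ℕd]*d a (suc d))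

lower-rep : ∀ (k i : ℤ) n .{{_ : NonZero n}} →
  (k ℤ.* ℚ.↧ (i ℚ./ n) ℤ.≤ ℚ.↥ (i ℚ./ n)) ⇔ (k ℤ.* + n ℤ.≤ i)
lower-rep k i n = begin
  (k ℤ.* ℚ.↧ x ℤ.≤ ℚ.↥ x)           ≡⟨ cong (k ℤ.* ℚ.↧ x ℤ.≤_) (sym (ℤP.*-identityʳ (ℚ.↥ x))) ⟩
  (k ℤ.* ℚ.↧ x ℤ.≤ ℚ.↥ x ℤ.* + 1)   ≈⟨ ⇔-sym (/-≤⇔ k (ℚ.↥ x) 1 (ℚ.↧ₙ x)) ⟩
  (k ℚ./ 1 ℚ.≤ ℚ.↥ x ℚ./ ℚ.↧ₙ x)    ≡⟨ cong (k ℚ./ 1 ℚ.≤_) (ℚP.↥p/↧p≡p x) ⟩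
  (k ℚ./ 1 ℚ.≤ i ℚ./ n)             ≈⟨ /-≤⇔ k i 1 n ⟩
  (k ℤ.* + n ℤ.≤ i ℤ.* + 1)         ≡⟨ cong (k ℤ.* + n ℤ.≤_) (ℤP.*-identityʳ i) ⟩
  (k ℤ.* + n ℤ.≤ i)                 ∎
  where
  open ⇔-Reasoning
  x : ℚ
  x = i ℚ./ n

upper-rep : ∀ (k i : ℤ) n .{{_ : NonZero n}} →
  (ℚ.↥ (i ℚ./ n) ℤ.< k ℤ.* ℚ.↧ (i ℚ./ n)) ⇔ (i ℤ.< k ℤ.* + n)
upper-rep k i n = begin
  (ℚ.↥ x ℤ.< k ℤ.* ℚ.↧ x)           ≡⟨ cong (ℤ._< k ℤ.* ℚ.↧ x) (sym (ℤP.*-identityʳ (ℚ.↥ x))) ⟩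
  (ℚ.↥ x ℤ.* + 1 ℤ.< k ℤ.* ℚ.↧ x)   ≈⟨ ⇔-sym (/-<⇔ (ℚ.↥ x) k (ℚ.↧ₙ x) 1) ⟩
  (ℚ.↥ x ℚ./ ℚ.↧ₙ x ℚ.< k ℚ./ 1)    ≡⟨ cong (ℚ._< k ℚ./ 1) (ℚP.↥p/↧p≡p x) ⟩
  (i ℚ./ n ℚ.< k ℚ./ 1)             ≈⟨ /-<⇔ i k n 1 ⟩
  (i ℤ.* + 1 ℤ.< k ℤ.* + n)         ≡⟨ cong (ℤ._< k ℤ.* + n) (ℤP.*-identityʳ i) ⟩
  (i ℤ.< k ℤ.* + n)                 ∎
  where
  open ⇔-Reasoning
  x : ℚ
  x = i ℚ./ n

floor-/ : ∀ (k i : ℤ) n .{{_ : NonZero n}} →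
  (k ≡ ℚ.floor (i ℚ./ n)) ⇔ ((k ℤ.* + n ℤ.≤ i) × (i ℤ.< ℤ.suc k ℤ.* + n))
floor-/ k i n = (lower-rep k i n ×-⇔ upper-rep (ℤ.suc k) i n) ⇔-∘ floor-char k (i ℚ./ n)

add-sub-cancel : ∀ (a c : ℤ) → a ℤ.+ c ℤ.- c ≡ a
add-sub-cancel = solve-∀

shift-≤ : ∀ {a b a' b' : ℤ} c → a ℤ.+ c ≡ a' → b ℤ.+ c ≡ b' → (a ℤ.≤ b) ⇔ (a' ℤ.≤ b')
shift-≤ {a} {b} c refl refl = mk⇔ (ℤP.+-monoˡ-≤ c)
  (λ h → subst₂ ℤ._≤_ (add-sub-cancel a c) (add-sub-cancel b c) (ℤP.+-monoˡ-≤ (ℤ.- c) h))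

shift-< : ∀ {a b a' b' : ℤ} c → a ℤ.+ c ≡ a' → b ℤ.+ c ≡ b' → (a ℤ.< b) ⇔ (a' ℤ.< b')
shift-< {a} {b} c refl refl = mk⇔ (ℤP.+-monoˡ-< c)
  (λ h → subst₂ ℤ._<_ (add-sub-cancel a c) (add-sub-cancel b c) (ℤP.+-monoˡ-< (ℤ.- c) h))

digit-window : ∀ {Δ : ℤ} d r A B → Δ ≡ d ℤ.* r ℤ.+ (A ℤ.- B) →
  ((d ℤ.* r ℤ.≤ Δ) × (Δ ℤ.< ℤ.suc d ℤ.* r)) ⇔ ((B ℤ.≤ A) × (A ℤ.< r ℤ.+ B))
digit-window d r A B refl = shift-≤ c (left d r B) (middle d r A B)
                       ×-⇔ shift-< c (middle d r A B) (trans (cong (ℤ._+ c) (ℤP.suc-* d r)) (right d r B))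
  where
  c : ℤ
  c = B ℤ.- d ℤ.* r
  left : ∀ d r B → d ℤ.* r ℤ.+ (B ℤ.- d ℤ.* r) ≡ B
  left = solve-∀
  middle : ∀ d r A B → d ℤ.* r ℤ.+ (A ℤ.- B) ℤ.+ (B ℤ.- d ℤ.* r) ≡ A
  middle = solve-∀
  right : ∀ d r B → r ℤ.+ d ℤ.* r ℤ.+ (B ℤ.- d ℤ.* r) ≡ r ℤ.+ B
  right = solve-∀

chain : ∀ {A : Set} (R : A → A → Set) → (∀ {x} → R x x) → (∀ {x y z} → R x y → R y z → R x z) →
  (f : ℕ → A) → (∀ n → R (f n) (f (suc n))) → ∀ {m n} → m ≤ n → R (f m) (f n)
chain R refl′ trans′ f step m≤n = go (ℕP.≤⇒≤′ m≤n)
  where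
  go : ∀ {m n} → m ℕ.≤′ n → R (f m) (f n)
  go ℕ.≤′-refl = refl′
  go (ℕ.≤′-step h) = trans′ (go h) (step _)

module ℚ-Identities where
  open +-*-Solver

  neg-sub : ∀ a b → ℚ.- a ℚ.- ℚ.- b ≡ ℚ.- (a ℚ.- b)
  neg-sub = solve 2 (λ a b → :- a :- :- b := :- (a :- b)) refl

  sub-swap : ∀ a b → a ℚ.- b ≡ ℚ.- (b ℚ.- a)
  sub-swap = solve 2 (λ a b → a :- b := :- (b :- a)) refl

  add-sub : ∀ a e → a ℚ.+ e ℚ.- a ≡ e
  add-sub = solve 2 (λ a e → a :+ e :- a := e) refl

  neg-neg : ∀ a → ℚ.- ℚ.- a ≡ a
  neg-neg = solve 1 (λ a → :- :- a := a) refl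

open ℚ-Identities

positive-gap : ∀ {a b} → a ℚ.< b → 0ℚ ℚ.< b ℚ.- a
positive-gap {a} {b} a<b = subst (ℚ._< b ℚ.- a) (ℚP.+-inverseʳ a) (ℚP.+-monoˡ-< (ℚ.- a) a<b)

limit-≥ : ∀ {s L c} → ConvergesTo s L → ∀ n₀ → (∀ m → n₀ ≤ m → c ℚ.≤ s m) → c ℚ.≤ L
limit-≥ {s} {L} {c} conv n₀ bound with c ℚP.≤? L
... | yes c≤L = c≤L
... | no c≰L = ⊥-elim (ℚP.<-irrefl refl (ℚP.<-≤-trans close far))
  where
  gap : 0ℚ ℚ.< c ℚ.- L
  gap = positive-gap (ℚP.≰⇒> c≰L)
  N m : ℕ
  N = proj₁ (conv (c ℚ.- L) gap)
  m = N ℕ.⊔ n₀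
  close : ℚ.∣ s m ℚ.- L ∣ ℚ.< c ℚ.- L
  close = proj₂ (conv (c ℚ.- L) gap) m (ℕP.m≤m⊔n N n₀)
  c-L≤s-L : c ℚ.- L ℚ.≤ s m ℚ.- L
  c-L≤s-L = ℚP.+-monoˡ-≤ (ℚ.- L) (bound m (ℕP.m≤n⊔m N n₀))
  far : c ℚ.- L ℚ.≤ ℚ.∣ s m ℚ.- L ∣
  far = subst (c ℚ.- L ℚ.≤_) (sym (ℚP.0≤p⇒∣p∣≡p (ℚP.≤-trans (ℚP.<⇒≤ gap) c-L≤s-L)))
          c-L≤s-L

converges-neg : ∀ {s L} → ConvergesTo s L → ConvergesTo (λ n → ℚ.- s n) (ℚ.- L)
converges-neg {s} {L} conv ε ε>0 with conv ε ε>0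
... | N , near = N , λ n N≤n →
  subst (ℚ._< ε) (sym (trans (cong ℚ.∣_∣ (neg-sub (s n) L)) (ℚP.∣-p∣≡∣p∣ (s n ℚ.- L))))
    (near n N≤n)

limit-≤ : ∀ {s L c} → ConvergesTo s L → ∀ n₀ → (∀ m → n₀ ≤ m → s m ℚ.≤ c) → L ℚ.≤ c
limit-≤ {s} {L} {c} conv n₀ bound =
  subst₂ ℚ._≤_ (neg-neg L) (neg-neg c) (ℚP.neg-antimono-≤ -c≤-L)
  where
  -c≤-L : ℚ.- c ℚ.≤ ℚ.- L
  -c≤-L = limit-≥ (converges-neg {s} {L} conv) n₀ (λ m n₀≤m → ℚP.neg-antimono-≤ (bound m n₀≤m))

within : ∀ {x L e} → x ℚ.≤ L → L ℚ.< x ℚ.+ e → ℚ.∣ x ℚ.- L ∣ ℚ.< e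
within {x} {L} {e} x≤L L<x+e = subst (ℚ._< e) (sym distance) (subst (L ℚ.- x ℚ.<_) (add-sub x e) shifted)
  where
  shifted : L ℚ.- x ℚ.< x ℚ.+ e ℚ.- x
  shifted = ℚP.+-monoˡ-< (ℚ.- x) L<x+e
  0≤L-x : 0ℚ ℚ.≤ L ℚ.- x
  0≤L-x = subst (ℚ._≤ L ℚ.- x) (ℚP.+-inverseʳ x) (ℚP.+-monoˡ-≤ (ℚ.- x) x≤L)
  distance : ℚ.∣ x ℚ.- L ∣ ≡ L ℚ.- x
  distance = trans (cong ℚ.∣_∣ (sub-swap x L))
                   (trans (ℚP.∣-p∣≡∣p∣ (L ℚ.- x)) (ℚP.0≤p⇒∣p∣≡p 0≤L-x))

converges-at-rate : ∀ {s L} → (∀ n → ℚ.∣ s (suc n) ℚ.- L ∣ ℚ.< + 1 ℚ./ suc n) → ConvergesTo s L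
converges-at-rate close ε@(mkℚ +[1+ a ] d _) _ = suc d , λ { (suc m) (s≤s d≤m) →
  ℚP.<-≤-trans (close m) (subst (+ 1 ℚ./ suc m ℚ.≤_) (ℚP.↥p/↧p≡p ε)
    (from (ℕ/-≤⇔ 1 (suc a) (suc m) (suc d)) (1+d≤[1+a][1+m] d≤m))) }
  where
  1+d≤[1+a][1+m] : ∀ {m} → d ≤ m → 1 ℕ.* suc d ≤ suc a ℕ.* suc m
  1+d≤[1+a][1+m] {m} d≤m = subst (_≤ suc a ℕ.* suc m) (sym (ℕP.*-identityˡ (suc d)))
    (ℕP.≤-trans (s≤s d≤m) (ℕP.m≤n*m (suc m) (suc a)))
-- (A positive ε has a positive numerator, so the other cases are impossible.)
converges-at-rate close (mkℚ +0 _ _) ε>0 with ℚP.drop-*<* ε>0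
... | ℤ.+<+ ()
converges-at-rate close (mkℚ -[1+ _ ] _ _) ε>0 with ℚP.drop-*<* ε>0
... | ()

module DigitExpansion (q : ℕ → ℕ) (hq : ∀ k → 1 < q k) (δ : ℕ → ℕ) (hδ : ∀ k → δ k < q k) where

  D : ℕ → ℕ
  D = qprod q

  D≢0 : ∀ n → NonZero (D n)
  D≢0 = qprod-nonZero q hq

  -- N n is the numerator of S_{n+1} over D n.
  N : ℕ → ℕ
  N zero    = δ zero
  N (suc n) = N n ℕ.* q (suc n) ℕ.+ δ (suc n)

  N-suc : ∀ n → + N (suc n) ≡ + N n ℤ.* + q (suc n) ℤ.+ + δ (suc n)
  N-suc n = trans (ℤP.pos-+ (N n ℕ.* q (suc n)) (δ (suc n)))
                  (cong (ℤ._+ + δ (suc n)) (ℤP.pos-* (N n) (q (suc n))))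

  S : ℕ → ℚ
  S = partialSum q hq δ

  U : ℕ → ℚ
  U n = (+ suc (N n) ℚ./ D n) {{D≢0 n}}

  S-frac : ∀ n → S (suc n) ≡ (+ N n ℚ./ D n) {{D≢0 n}}
  S-frac zero    = ℚP.+-identityˡ _
  S-frac (suc n) = begin
    S (suc n) ℚ.+ + δ (suc n) ℚ./ D (suc n)
      ≡⟨ cong (ℚ._+ + δ (suc n) ℚ./ D (suc n)) (S-frac n) ⟩
    + N n ℚ./ D n ℚ.+ + δ (suc n) ℚ./ (D n ℕ.* q (suc n))
      ≡⟨ /-+-refine (+ N n) (+ δ (suc n)) (D n) (q (suc n)) ⟩
    (+ N n ℤ.* + q (suc n) ℤ.+ + δ (suc n)) ℚ./ D (suc n)
      ≡⟨ cong (ℚ._/ D (suc n)) (sym (N-suc n)) ⟩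
    + N (suc n) ℚ./ D (suc n) ∎
    where
    open ≡-Reasoning
    instance
      _ = D≢0 n
      _ = D≢0 (suc n)

  S-mono : ∀ {m n} → m ≤ n → S m ℚ.≤ S n
  S-mono = chain ℚ._≤_ ℚP.≤-refl ℚP.≤-trans S λ m →
    subst (ℚ._≤ S (suc m)) (ℚP.+-identityʳ (S m))
      (ℚP.+-monoʳ-≤ (S m) (from (ℕ/-≤⇔ 0 (δ m) 1 (D m) {{_}} {{D≢0 m}}) ℕ.z≤n))

  D-≥ : ∀ n → suc n ≤ D n
  D-≥ zero    = ℕP.<⇒≤ (hq zero)
  D-≥ (suc n) = ℕP.≤-trans (s≤s (D-≥ n)) (ℕP.m<m*n (D n) (q (suc n)) {{D≢0 n}} (hq (suc n)))

  U-split : ∀ n → U n ≡ S (suc n) ℚ.+ (+ 1 ℚ./ D n) {{D≢0 n}}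
  U-split n = sym (begin
    S (suc n) ℚ.+ + 1 ℚ./ D n     ≡⟨ cong (ℚ._+ + 1 ℚ./ D n) (S-frac n) ⟩
    + N n ℚ./ D n ℚ.+ + 1 ℚ./ D n  ≡⟨ /-+-same (+ N n) (+ 1) (D n) ⟩
    (+ N n ℤ.+ + 1) ℚ./ D n        ≡⟨ cong (ℚ._/ D n) (ℤP.+-comm (+ N n) (+ 1)) ⟩
    U n                            ∎)
    where
    open ≡-Reasoning
    instance _ = D≢0 n

  -- Passing from D k to D (k+1) = D k·q_{k+1}, the numerator N k + 1 becomes
  -- (N k + 1)·q_{k+1} = N (k+1) + (q_{k+1} − δ_{k+1}).
  numerator-bound : ∀ k x → x ℕ.+ δ (suc k) ≤ q (suc k) →
    x ℕ.+ N (suc k) ≤ suc (N k) ℕ.* q (suc k)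
  numerator-bound k x h = begin
    x ℕ.+ (N k ℕ.* q (suc k) ℕ.+ δ (suc k))   ≡⟨ swap x (N k ℕ.* q (suc k)) (δ (suc k)) ⟩
    N k ℕ.* q (suc k) ℕ.+ (x ℕ.+ δ (suc k))   ≤⟨ ℕP.+-monoʳ-≤ (N k ℕ.* q (suc k)) h ⟩
    N k ℕ.* q (suc k) ℕ.+ q (suc k)           ≡⟨ ℕP.+-comm (N k ℕ.* q (suc k)) (q (suc k)) ⟩
    suc (N k) ℕ.* q (suc k)                   ∎
    where
    open ℕP.≤-Reasoning
    swap : ∀ x a d → x ℕ.+ (a ℕ.+ d) ≡ a ℕ.+ (x ℕ.+ d)
    swap = ℕSolver.solve-∀

  U-antitone : ∀ {m n} → m ≤ n → U n ℚ.≤ U m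
  U-antitone = chain (λ x y → y ℚ.≤ x) ℚP.≤-refl (λ x≥y y≥z → ℚP.≤-trans y≥z x≥y) U λ k →
    refine-≤ (suc (N (suc k))) (suc (N k)) (D k) (q (suc k)) {{D≢0 k}} {{D≢0 (suc k)}}
      (numerator-bound k 1 (hδ (suc k)))

  U-drop : ∀ k → suc (δ (suc k)) ≢ q (suc k) → U (suc k) ℚ.< U k
  U-drop k notMax = refine-< (suc (N (suc k))) (suc (N k)) (D k) (q (suc k)) {{D≢0 k}} {{D≢0 (suc k)}}
    (numerator-bound k 2 (ℕP.≤∧≢⇒< (hδ (suc k)) notMax))

  S≤U : ∀ {n m} → n ≤ m → S (suc m) ℚ.≤ U n
  S≤U {n} {m} n≤m = ℚP.≤-trans S≤Um (U-antitone n≤m)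
    where
    S≤Um : S (suc m) ℚ.≤ U m
    S≤Um = subst (ℚ._≤ U m) (sym (S-frac m))
      (from (ℕ/-≤⇔ (N m) (suc (N m)) (D m) (D m) {{D≢0 m}} {{D≢0 m}}) (ℕP.*-monoˡ-≤ (D m) (ℕP.n≤1+n (N m))))

  module _ {L : ℚ} where

    S≤limit : ConvergesTo S L → ∀ n → S n ℚ.≤ L
    S≤limit conv n = limit-≥ {S} conv n (λ m → S-mono)

    limit≤U : ConvergesTo S L → ∀ k → L ℚ.≤ U k
    limit≤U conv k = limit-≤ {S} conv (suc k) λ { (suc m) (s≤s k≤m) → S≤U k≤m }

    -- If the limit reaches U n, then every digit after position n is maximal:
    -- a non-maximal digit would push U strictly below the limit.
    tail-maximal : ConvergesTo S L → ∀ n → U n ℚ.≤ L → ∀ k → suc n ≤ k → suc (δ k) ≡ q k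
    tail-maximal conv n Un≤L (suc j) (s≤s n≤j) with suc (δ (suc j)) ℕP.≟ q (suc j)
    ... | yes maximal   = maximal
    ... | no  notMaximal = ⊥-elim (ℚP.<-irrefl refl (ℚP.<-≤-trans (U-drop j notMaximal)
            (ℚP.≤-trans (U-antitone n≤j) (ℚP.≤-trans Un≤L (limit≤U conv (suc j))))))

    -- L is bracketed at level n when S_{n+1} ≤ L < U n, i.e. when the
    -- first n+1 digits of L are δ 0, …, δ n.
    Bracketed : ℕ → Set
    Bracketed n = (S (suc n) ℚ.≤ L) × (L ℚ.< U n)

    converges⇒bracketed : ConvergesTo S L → ¬ (∃ λ m → ∀ k → m ≤ k → suc (δ k) ≡ q k) →
      ∀ n → Bracketed n
    converges⇒bracketed conv notEventuallyMaximal n = S≤limit conv (suc n) , L<Un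
      where
      L<Un : L ℚ.< U n
      L<Un with L ℚP.<? U n
      ... | yes L<Un = L<Un
      ... | no  L≮Un = ⊥-elim (notEventuallyMaximal (suc n , tail-maximal conv n (ℚP.≮⇒≥ L≮Un)))

    -- Conversely, if L is bracketed at every level then |S_{n+1} − L| < 1/D n ≤ 1/(n+1).
    bracketed⇒converges : (∀ n → Bracketed n) → ConvergesTo S L
    bracketed⇒converges bracketed = converges-at-rate {S} λ n →
      ℚP.<-≤-trans (within (proj₁ (bracketed n)) (subst (L ℚ.<_) (U-split n) (proj₂ (bracketed n))))
        (from (ℕ/-≤⇔ 1 1 (D n) (suc n) {{D≢0 n}}) (ℕP.*-monoʳ-≤ 1 (D-≥ n)))

  module _ (p r : ℕ) .{{_ : NonZero r}} where

    -- Δ_n = r·δ_n + (p·D n − r·N n): besides the current digit, Δ_n carries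
    -- r·D n times the gap p/r − S_{n+1}.
    Delta-identity : ∀ n → Delta q δ p r n ≡ + δ n ℤ.* + r ℤ.+ (+ p ℤ.* + D n ℤ.- + N n ℤ.* + r)
    Delta-identity zero    = base (+ p ℤ.* + q zero) (+ δ zero ℤ.* + r)
      where
      base : ∀ x y → x ≡ y ℤ.+ (x ℤ.- y)
      base = solve-∀
    Delta-identity (suc n) = begin
      q' ℤ.* (Delta q δ p r n ℤ.- + r ℤ.* + δ n)
        ≡⟨ cong (λ Δ → q' ℤ.* (Δ ℤ.- + r ℤ.* + δ n)) (Delta-identity n) ⟩
      q' ℤ.* (+ δ n ℤ.* + r ℤ.+ (+ p ℤ.* + D n ℤ.- + N n ℤ.* + r) ℤ.- + r ℤ.* + δ n)
        ≡⟨ step q' (+ δ n) (+ δ (suc n)) (+ r) (+ p) (+ D n) (+ N n) ⟩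
      + δ (suc n) ℤ.* + r ℤ.+ (+ p ℤ.* (+ D n ℤ.* q') ℤ.- (+ N n ℤ.* q' ℤ.+ + δ (suc n)) ℤ.* + r)
        ≡⟨ cong₂ (λ x y → + δ (suc n) ℤ.* + r ℤ.+ (+ p ℤ.* x ℤ.- y ℤ.* + r))
             (sym (ℤP.pos-* (D n) (q (suc n)))) (sym (N-suc n)) ⟩
      + δ (suc n) ℤ.* + r ℤ.+ (+ p ℤ.* + D (suc n) ℤ.- + N (suc n) ℤ.* + r) ∎
      where
      open ≡-Reasoning
      q' : ℤ
      q' = + q (suc n)
      step : ∀ q' d d' r p D N →
        q' ℤ.* (d ℤ.* r ℤ.+ (p ℤ.* D ℤ.- N ℤ.* r) ℤ.- r ℤ.* d)
          ≡ d' ℤ.* r ℤ.+ (p ℤ.* (D ℤ.* q') ℤ.- (N ℤ.* q' ℤ.+ d') ℤ.* r)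
      step = solve-∀

    digit-rule⇔bracketed : ∀ n → (+ δ n ≡ ℚ.floor (Delta q δ p r n ℚ./ r)) ⇔ Bracketed {+ p ℚ./ r} n
    digit-rule⇔bracketed n = begin
      (+ δ n ≡ ℚ.floor (Delta q δ p r n ℚ./ r))
        ≈⟨ floor-/ (+ δ n) (Delta q δ p r n) r ⟩
      ((+ δ n ℤ.* + r ℤ.≤ Delta q δ p r n) × (Delta q δ p r n ℤ.< ℤ.suc (+ δ n) ℤ.* + r))
        ≈⟨ digit-window (+ δ n) (+ r) (+ p ℤ.* + D n) (+ N n ℤ.* + r) (Delta-identity n) ⟩
      ((+ N n ℤ.* + r ℤ.≤ + p ℤ.* + D n) × (+ p ℤ.* + D n ℤ.< + r ℤ.+ + N n ℤ.* + r))
        ≡⟨ cong₂ _×_ (cong₂ ℤ._≤_ (sym (ℤP.pos-* (N n) r)) (sym (ℤP.pos-* p (D n))))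
                     (cong₂ ℤ._<_ (sym (ℤP.pos-* p (D n))) upper-cast) ⟩
      ((+ (N n ℕ.* r) ℤ.≤ + (p ℕ.* D n)) × (+ (p ℕ.* D n) ℤ.< + (suc (N n) ℕ.* r)))
        ≈⟨ mk⇔ ℤP.drop‿+≤+ ℤ.+≤+ ×-⇔ mk⇔ ℤP.drop‿+<+ ℤ.+<+ ⟩
      ((N n ℕ.* r ≤ p ℕ.* D n) × (p ℕ.* D n < suc (N n) ℕ.* r))
        ≈⟨ ⇔-sym (ℕ/-≤⇔ (N n) p (D n) r ×-⇔ ℕ/-<⇔ p (suc (N n)) r (D n)) ⟩
      ((+ N n ℚ./ D n ℚ.≤ + p ℚ./ r) × (+ p ℚ./ r ℚ.< U n))
        ≡⟨ cong (λ x → (x ℚ.≤ + p ℚ./ r) × (+ p ℚ./ r ℚ.< U n)) (sym (S-frac n)) ⟩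
      Bracketed {+ p ℚ./ r} n ∎
      where
      open ⇔-Reasoning
      instance _ = D≢0 n
      upper-cast : + r ℤ.+ + N n ℤ.* + r ≡ + (suc (N n) ℕ.* r)
      upper-cast = trans (cong (ℤ._+_ (+ r)) (sym (ℤP.pos-* (N n) r))) (sym (ℤP.pos-+ r (N n ℕ.* r)))

mainTheorem3 : (q : ℕ → ℕ) (hq : ∀ k → 1 < q k) (p r : ℕ) .{{_ : NonZero r}} →
  0 < p → gcd p r ≡ 1 → p < r →
  (δ : ℕ → ℕ) → (∀ k → δ k < q k) →
  ¬ (∃ λ m → ∀ k → m ≤ k → suc (δ k) ≡ q k) →
  (∃ λ n → 0ℚ ℚ.< partialSum q hq δ n) →
  (∃ λ ε → (0ℚ ℚ.< ε) × (∀ n → partialSum q hq δ n ℚ.≤ 1ℚ ℚ.- ε)) →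
  (ConvergesTo (partialSum q hq δ) (ℚ._/_ (+ p) r)
    ⇔ ((+ δ 0 ≡ ℚ.floor (ℚ._/_ (Delta q δ p r 0) r))
       × (∀ n → + δ (suc n) ≡ ℚ.floor (ℚ._/_ (+ q (suc n) ℤ.* (Delta q δ p r n ℤ.- + r ℤ.* + δ n)) r))))
mainTheorem3 q hq p r _ _ _ δ hδ notEventuallyMaximal _ _ = mk⇔
  (λ conv → let bracketed = converges⇒bracketed conv notEventuallyMaximal in
    from (rule 0) (bracketed 0) , λ n → from (rule (suc n)) (bracketed (suc n)))
  (λ (rule₀ , ruleₛ) → bracketed⇒converges λ where
    zero    → to (rule 0) rule₀
    (suc n) → to (rule (suc n)) (ruleₛ n))
  where
  open DigitExpansion q hq δ hδ
  -- For n ≥ 1 the statement's q_n·(Δ_{n-1} − r·δ_{n-1}) is Delta q δ p r n by definition.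
  rule : ∀ n → (+ δ n ≡ ℚ.floor (Delta q δ p r n ℚ./ r)) ⇔ Bracketed {+ p ℚ./ r} n
  rule = digit-rule⇔bracketed p r
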